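{- Let $a_0,\ldots,a_s$ be positive integers ($s\ge0$). Then there exist a poset $P=(X,\prec)$ of width two with $|X|=a_0+\cdots+a_s$ and an element $x\in\min(P)$ such that $\rho(P,x)=[a_0;a_1,\ldots,a_s]$.
   Context: $[a_0;a_1,\ldots,a_s]$ denotes the finite continued fraction $a_0+\cfrac{1}{a_1+\cfrac{1}{\ddots+\frac{1}{a_s}}}$. The width of a poset is the maximum size of an antichain. For a finite poset $P$, $e(P)$ is its number of linear extensions; for a minimal element $x$, $\rho(P,x):=e(P)/e(P-x)$, where $P-x$ is the subposet on $X\setminus\{x\}$. -}

module Defs where

open import Data.Nat using (ℕ; zero; suc; _≤_)
open import Data.Bool using (Bool; true; false; not; T)
open import Data.Fin using (Fin; _≟_)
open import Data.Fin.Properties using (all?)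
open import Data.List using (List; []; _∷_; length; map; concatMap; filter; upTo; allFin)
open import Data.List.Relation.Unary.AllPairs using (AllPairs; allPairs?)
open import Data.List.Relation.Unary.Unique.Propositional using (Unique)
open import Data.List.Membership.Propositional using (_∈_)
import Data.List.Membership.DecPropositional as DecMem
open import Data.Product using (_×_)
open import Data.Integer using (+_)
open import Data.Rational using (ℚ; 0ℚ; _+_; _/_; 1/_; ≢-nonZero)
import Data.Rational.Properties as ℚP
open import Data.Bool.Properties using (T?)
open import Relation.Binary.Core using (Rel)
open import Relation.Binary.Definitions using (Decidable)
open import Relation.Binary.Structures using (IsStrictPartialOrder)
open import Relation.Binary.PropositionalEquality using (_≡_; _≢_)
open import Relation.Nullary using (¬_; Dec; yes; no; _×-dec_; _→-dec_; ¬?; ⌊_⌋)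

record FinPoset (n : ℕ) : Set₁ where
  field
    _≺_      : Rel (Fin n) _
    isSPO    : IsStrictPartialOrder _≡_ _≺_
    _≺?_     : Decidable _≺_

open FinPoset public

Incomparable : ∀ {n} → FinPoset n → Fin n → Fin n → Set
Incomparable P x y = x ≢ y × ¬ (_≺_ P x y) × ¬ (_≺_ P y x)

IsAntichain : ∀ {n} → FinPoset n → List (Fin n) → Set
IsAntichain P l = AllPairs (Incomparable P) l

WidthAtMostTwo : ∀ {n} → FinPoset n → Set
WidthAtMostTwo P = ∀ l → IsAntichain P l → length l ≤ 2

IsMinimal : ∀ {n} → FinPoset n → Fin n → Set
IsMinimal P x = ∀ y → ¬ (_≺_ P y x)

-- Linear extensions of the subposet of P induced on {y | T (keep y)}:
-- a repetition-free listing of exactly the kept elements in which no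
-- element is preceded by an element strictly above it.

IsLinExt : ∀ {n} → FinPoset n → (Fin n → Bool) → List (Fin n) → Set
IsLinExt P keep l =
  Unique l ×
  (∀ y → (T (keep y) → y ∈ l) × (y ∈ l → T (keep y))) ×
  AllPairs (λ u v → ¬ (_≺_ P v u)) l

isLinExt? : ∀ {n} (P : FinPoset n) (keep : Fin n → Bool) → (l : List (Fin n)) → Dec (IsLinExt P keep l)
isLinExt? {n} P keep l =
  allPairs? (λ u v → ¬? (u ≟ v)) l
  ×-dec all? (λ y → (T? (keep y) →-dec (DecMem._∈?_ (_≟_ {n}) y l)) ×-dec ((DecMem._∈?_ (_≟_ {n}) y l) →-dec T? (keep y)))
  ×-dec allPairs? (λ u v → ¬? (_≺?_ P v u)) l

listsOfLength : (n k : ℕ) → List (List (Fin n))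
listsOfLength n zero    = [] ∷ []
listsOfLength n (suc k) = concatMap (λ l → map (_∷ l) (allFin n)) (listsOfLength n k)

-- all lists of length ≤ n over Fin n (each exactly once); every linear
-- extension of a subposet of P is among them

allShortLists : (n : ℕ) → List (List (Fin n))
allShortLists n = concatMap (listsOfLength n) (upTo (suc n))

eSub : ∀ {n} → FinPoset n → (Fin n → Bool) → ℕ
eSub {n} P keep = length (filter (isLinExt? P keep) (allShortLists n))

e : ∀ {n} → FinPoset n → ℕ
e P = eSub P (λ _ → true)

eMinus : ∀ {n} → FinPoset n → Fin n → ℕ
eMinus P x = eSub P (λ y → not ⌊ y ≟ x ⌋)

-- m / d as a rational (convention m / 0 = 0; never relevant below,
-- since e(P - x) ≥ 1 for every finite poset)
frac : ℕ → ℕ → ℚ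
frac m zero    = 0ℚ
frac m (suc d) = (+ m) / suc d

-- total inverse (1/0 = 0 convention; only applied to positive values)
inv : ℚ → ℚ
inv p with p ℚP.≟ 0ℚ
... | yes _  = 0ℚ
... | no p≢0 = 1/_ p {{≢-nonZero p≢0}}

ρ : ∀ {n} → FinPoset n → Fin n → ℚ
ρ P x = frac (e P) (eMinus P x)

-- continued fraction [a₀; a₁, …, a_s] with a₀ given separately and
-- the list a₁ ∷ … ∷ a_s
cf : ℕ → List ℕ → ℚ
cf a []       = frac a 1
cf a (b ∷ bs) = frac a 1 + inv (cf b bs)

-- Cut the positions 0, …, N − 1 (N = a₀ + ⋯ + a_s) into consecutive blocks of lengths a₀, …, a_s
-- and order them as a chain, except that the first element of each block is incomparable with the
-- rest of its block and with the first element of the next block. No three positions are pairwise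
-- incomparable, so the width is two, and position 0 is minimal.
-- Let E(k) be the number of linear extensions of the positions ≥ k, so E(0) = e(P) and
-- E(1) = e(P − 0). Counting linear extensions by their first element, a block starting at o with
-- length a and successor block at q = o + a gives E(o + 1) = E(q) and E(o) = a·E(q) + E(q + 1),
-- or E(o) = a for the last block. These are the recurrences of the continuants of
-- [a₀; a₁, …, a_s], whence E(0) / E(1) = [a₀; a₁, …, a_s].

module Submission where

open import Defs
open import Data.Empty using (⊥; ⊥-elim)
open import Data.Product using (Σ; _×_; _,_; proj₁; proj₂)
open import Data.Sum using (_⊎_; inj₁; inj₂)
import Data.Sum as Sum
open import Data.Bool using (Bool; true; T; not; _∧_; _∨_)
open import Data.Bool.Properties using (T-∧; T-∨)
open import Data.Nat as ℕ using (ℕ; zero; suc; _+_; _*_; _∸_; _≤_; _<_; _≤?_; _<?_; z≤n; s≤s)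
import Data.Nat.Properties as ℕ
open import Data.Nat.Tactic.RingSolver using (solve-∀)
open import Data.Nat.ListAction using (sum)
open import Data.Fin using (Fin; _≟_; toℕ; fromℕ<)
import Data.Fin.Properties as Fin
open import Data.List using (List; []; _∷_; length; map; concatMap; allFin; filter)
open import Data.List.Properties
  using (length-++; length-map; length-tabulate; length-removeAt′; map-cong; ∷-injectiveˡ; ∷-injectiveʳ)
open import Data.List.Membership.Propositional using (_∈_; _─_; find; lose)
open import Data.List.Membership.Propositional.Properties
  using (∈-filter⁺; ∈-filter⁻; ∈-map⁺; ∈-map⁻; ∈-concatMap⁺; ∈-concatMap⁻; ∈-allFin; ∈-upTo⁺)
open import Data.List.Relation.Binary.Disjoint.Propositional using (Disjoint)
open import Data.List.Relation.Binary.Subset.Propositional using (_⊆_)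
open import Data.List.Relation.Unary.Any using (here; there; index)
import Data.List.Relation.Unary.Any as Any
open import Data.List.Relation.Unary.All using (All; []; _∷_)
import Data.List.Relation.Unary.All as All
import Data.List.Relation.Unary.All.Properties as All
open import Data.List.Relation.Unary.AllPairs using ([]; _∷_)
import Data.List.Relation.Unary.AllPairs as AllPairs
import Data.List.Relation.Unary.AllPairs.Properties as AllPairs
open import Data.List.Relation.Unary.Unique.Propositional using (Unique)
import Data.List.Relation.Unary.Unique.Propositional.Properties as Unique
open import Function.Bundles using (Equivalence)
open import Relation.Nullary using (¬_; yes; no; ⌊_⌋; contradiction)
open import Relation.Nullary.Decidable using (toWitness; fromWitness; toWitnessFalse; fromWitnessFalse)
open import Relation.Binary.Definitions using (tri<; tri≈; tri>)
open import Relation.Binary.Structures using (IsStrictPartialOrder)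
open import Relation.Binary.PropositionalEquality

module ContinuedFractions where

  open import Data.Integer as ℤ using (+_)
  import Data.Integer.Properties as ℤ
  open import Data.Rational as ℚ using (0ℚ; 1ℚ; 1/_; toℚᵘ; ≢-nonZero; NonZero)
  import Data.Rational.Properties as ℚ
  open import Data.Rational.Unnormalised as ℚᵘ using (mkℚᵘ; *≡*) renaming (_≃_ to _≃ᵘ_)
  import Data.Rational.Unnormalised.Properties as ℚᵘ

  toℚᵘ-frac : ∀ m d → toℚᵘ (frac m (suc d)) ≃ᵘ mkℚᵘ (+ m) d
  toℚᵘ-frac m d = ℚ.toℚᵘ-fromℚᵘ (mkℚᵘ (+ m) d)

  +-*-+ : ∀ m n → + m ℤ.* + n ≡ + (m * n)
  +-*-+ m n = sym (ℤ.pos-* m n)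

  mkℚᵘ-*-+ : ∀ a f g → mkℚᵘ (+ (a * suc f + g)) f ≃ᵘ mkℚᵘ (+ a) 0 ℚᵘ.+ mkℚᵘ (+ g) f
  mkℚᵘ-*-+ a f g = *≡* (begin
      + (a * F + g) ℤ.* + (1 * F)          ≡⟨ +-*-+ (a * F + g) (1 * F) ⟩
      + ((a * F + g) * (1 * F))            ≡⟨ cong +_ (ℕ-identity a F g) ⟩
      + ((a * F + g * 1) * F)              ≡⟨ +-*-+ (a * F + g * 1) F ⟨
      + (a * F + g * 1) ℤ.* + F            ≡⟨ cong (ℤ._* + F) (ℤ.pos-+ (a * F) (g * 1)) ⟩
      (+ (a * F) ℤ.+ + (g * 1)) ℤ.* + F    ≡⟨ cong₂ (λ x y → (x ℤ.+ y) ℤ.* + F) (+-*-+ a F) (+-*-+ g 1) ⟨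
      (+ a ℤ.* + F ℤ.+ + g ℤ.* + 1) ℤ.* + F ∎)
    where
    open ≡-Reasoning
    F = suc f
    ℕ-identity : ∀ a F g → (a * F + g) * (1 * F) ≡ (a * F + g * 1) * F
    ℕ-identity = solve-∀

  frac-*-+ : ∀ a f g → frac (a * suc f + g) (suc f) ≡ frac a 1 ℚ.+ frac g (suc f)
  frac-*-+ a f g = ℚ.toℚᵘ-injective (begin-equality
      toℚᵘ (frac (a * suc f + g) (suc f))           ≃⟨ toℚᵘ-frac _ f ⟩
      mkℚᵘ (+ (a * suc f + g)) f                    ≃⟨ mkℚᵘ-*-+ a f g ⟩
      mkℚᵘ (+ a) 0 ℚᵘ.+ mkℚᵘ (+ g) f                ≃⟨ ℚᵘ.+-cong (toℚᵘ-frac a 0) (toℚᵘ-frac g f) ⟨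
      toℚᵘ (frac a 1) ℚᵘ.+ toℚᵘ (frac g (suc f))    ≃⟨ ℚ.toℚᵘ-homo-+ (frac a 1) (frac g (suc f)) ⟨
      toℚᵘ (frac a 1 ℚ.+ frac g (suc f))            ∎)
    where open ℚᵘ.≤-Reasoning

  frac-≢0 : ∀ f g → frac (suc f) (suc g) ≢ 0ℚ
  frac-≢0 f g eq with ℚᵘ.≃-trans (ℚᵘ.≃-sym (toℚᵘ-frac (suc f) g)) (ℚ.toℚᵘ-cong eq)
  ... | *≡* ()

  frac-*-frac-swap : ∀ f g → frac (suc f) (suc g) ℚ.* frac (suc g) (suc f) ≡ 1ℚ
  frac-*-frac-swap f g = ℚ.toℚᵘ-injective (begin-equality
      toℚᵘ (frac F G ℚ.* frac G F)              ≃⟨ ℚ.toℚᵘ-homo-* (frac F G) (frac G F) ⟩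
      toℚᵘ (frac F G) ℚᵘ.* toℚᵘ (frac G F)      ≃⟨ ℚᵘ.*-cong (toℚᵘ-frac F g) (toℚᵘ-frac G f) ⟩
      mkℚᵘ (+ F) g ℚᵘ.* mkℚᵘ (+ G) f            ≃⟨ *≡* (cong +_ (ℕ-identity f g)) ⟩
      toℚᵘ 1ℚ                                   ∎)
    where
    open ℚᵘ.≤-Reasoning
    F = suc f
    G = suc g
    ℕ-identity : ∀ f g → suc f * suc g * 1 ≡ 1 * (suc g * suc f)
    ℕ-identity = solve-∀

  inv-≢0 : ∀ p (p≢0 : p ≢ 0ℚ) → inv p ≡ 1/_ p {{≢-nonZero p≢0}}
  inv-≢0 p p≢0 with p ℚ.≟ 0ℚ
  ... | yes p≡0 = ⊥-elim (p≢0 p≡0)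
  ... | no  _   = refl

  inv-frac : ∀ f g → inv (frac (suc f) (suc g)) ≡ frac (suc g) (suc f)
  inv-frac f g = trans (inv-≢0 X (frac-≢0 f g)) (begin
      1/ X                     ≡⟨ ℚ.*-identityʳ (1/ X) ⟨
      1/ X ℚ.* 1ℚ              ≡⟨ cong (1/ X ℚ.*_) (frac-*-frac-swap f g) ⟨
      1/ X ℚ.* (X ℚ.* Y)       ≡⟨ ℚ.*-assoc (1/ X) X Y ⟨
      (1/ X ℚ.* X) ℚ.* Y       ≡⟨ cong (ℚ._* Y) (ℚ.*-inverseˡ X) ⟩
      1ℚ ℚ.* Y                 ≡⟨ ℚ.*-identityˡ Y ⟩
      Y                        ∎)
    where
    open ≡-Reasoning
    X = frac (suc f) (suc g)
    Y = frac (suc g) (suc f)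
    instance
      X-nonZero : NonZero X
      X-nonZero = ≢-nonZero (frac-≢0 f g)

  frac-*-+-inv : ∀ a {F G} → 0 < F → 0 < G → frac (a * F + G) F ≡ frac a 1 ℚ.+ inv (frac F G)
  frac-*-+-inv a {suc f} {suc g} _ _ =
    trans (frac-*-+ a f (suc g)) (cong (λ t → frac a 1 ℚ.+ t) (sym (inv-frac f g)))

  numerator   : ℕ → List ℕ → ℕ
  denominator : List ℕ → ℕ

  numerator a []       = a
  numerator a (b ∷ bs) = a * numerator b bs + denominator bs

  denominator []       = 1
  denominator (b ∷ bs) = numerator b bs

  numerator-pos   : ∀ {a} bs → 0 < a → All (0 <_) bs → 0 < numerator a bs
  denominator-pos : ∀ bs → All (0 <_) bs → 0 < denominator bs

  numerator-pos     []       0<a _          = 0<a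
  numerator-pos {a} (b ∷ bs) _   (_ ∷ 0<bs) =
    ℕ.<-≤-trans (denominator-pos bs 0<bs) (ℕ.m≤n+m _ (a * numerator b bs))

  denominator-pos []       _            = s≤s z≤n
  denominator-pos (b ∷ bs) (0<b ∷ 0<bs) = numerator-pos bs 0<b 0<bs

  cf-continuants : ∀ a bs → All (0 <_) bs → frac (numerator a bs) (denominator bs) ≡ cf a bs
  cf-continuants a []       _            = refl
  cf-continuants a (b ∷ bs) (0<b ∷ 0<bs) = begin
    frac (a * numerator b bs + denominator bs) (numerator b bs)
      ≡⟨ frac-*-+-inv a (numerator-pos bs 0<b 0<bs) (denominator-pos bs 0<bs) ⟩
    frac a 1 ℚ.+ inv (frac (numerator b bs) (denominator bs))
      ≡⟨ cong (λ t → frac a 1 ℚ.+ inv t) (cf-continuants b bs 0<bs) ⟩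
    cf a (b ∷ bs) ∎
    where open ≡-Reasoning

open ContinuedFractions using (numerator; denominator; cf-continuants)

module _ {A : Set} where

  ∈-─ : ∀ {x z : A} {xs} (x∈xs : x ∈ xs) → z ∈ xs → z ≢ x → z ∈ xs ─ x∈xs
  ∈-─ (here refl) (here refl) z≢x = ⊥-elim (z≢x refl)
  ∈-─ (here refl) (there z∈)  _   = z∈
  ∈-─ (there _)   (here refl) _   = here refl
  ∈-─ (there x∈)  (there z∈)  z≢x = there (∈-─ x∈ z∈ z≢x)

  Unique-⊆⇒length≤ : ∀ {xs ys : List A} → Unique xs → xs ⊆ ys → length xs ≤ length ys
  Unique-⊆⇒length≤ {[]}     _            _     = z≤n
  Unique-⊆⇒length≤ {x ∷ xs} {ys} (x∉xs ∷ u) xs⊆ys =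
    subst (suc (length xs) ≤_) (sym (length-removeAt′ ys (index x∈ys)))
      (s≤s (Unique-⊆⇒length≤ u xs⊆ys─x))
    where
    x∈ys = xs⊆ys (here refl)
    xs⊆ys─x : xs ⊆ ys ─ x∈ys
    xs⊆ys─x z∈xs = ∈-─ x∈ys (xs⊆ys (there z∈xs)) λ z≡x → All.lookup x∉xs z∈xs (sym z≡x)

  Unique-⊆⊇⇒length≡ : ∀ {xs ys : List A} → Unique xs → Unique ys → xs ⊆ ys → ys ⊆ xs →
                      length xs ≡ length ys
  Unique-⊆⊇⇒length≡ u v xs⊆ys ys⊆xs =
    ℕ.≤-antisym (Unique-⊆⇒length≤ u xs⊆ys) (Unique-⊆⇒length≤ v ys⊆xs)

  Unique-concatMap⁺ : ∀ {B : Set} (f : B → List A) {xs} → Unique xs → (∀ x → Unique (f x)) →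
                      (∀ {x y} → x ≢ y → Disjoint (f x) (f y)) → Unique (concatMap f xs)
  Unique-concatMap⁺ f {xs} u f-unique f-disjoint =
    Unique.concat⁺ (All.map⁺ (All.universal f-unique xs)) (AllPairs.map⁺ (AllPairs.map f-disjoint u))

  length-concatMap : ∀ {B : Set} (f : B → List A) xs →
                     length (concatMap f xs) ≡ sum (map (λ x → length (f x)) xs)
  length-concatMap f []       = refl
  length-concatMap f (x ∷ xs) = trans (length-++ (f x)) (cong (length (f x) +_) (length-concatMap f xs))

Unique⇒length≤ : ∀ {n} {xs : List (Fin n)} → Unique xs → length xs ≤ n
Unique⇒length≤ {n} {xs} u =
  subst (length xs ≤_) (length-tabulate {n = n} (λ i → i)) (Unique-⊆⇒length≤ u (λ {z} _ → ∈-allFin z))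

module _ (n : ℕ) where

  prepend : List (Fin n) → List (List (Fin n))
  prepend l = map (_∷ l) (allFin n)

  length-listsOfLength : ∀ k {l} → l ∈ listsOfLength n k → length l ≡ k
  length-listsOfLength zero    (here refl) = refl
  length-listsOfLength (suc k) l∈ with find (∈-concatMap⁻ prepend {xs = listsOfLength n k} l∈)
  ... | l′ , l′∈ , l∈map with ∈-map⁻ (_∷ l′) l∈map
  ... | _ , _ , refl = cong suc (length-listsOfLength k l′∈)

  ∈-listsOfLength : ∀ l → l ∈ listsOfLength n (length l)
  ∈-listsOfLength []      = here refl
  ∈-listsOfLength (x ∷ l) =
    ∈-concatMap⁺ prepend (Any.map (λ { refl → ∈-map⁺ (_∷ l) (∈-allFin x) }) (∈-listsOfLength l))

  listsOfLength-unique : ∀ k → Unique (listsOfLength n k)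
  listsOfLength-unique zero    = [] ∷ []
  listsOfLength-unique (suc k) = Unique-concatMap⁺ prepend (listsOfLength-unique k)
    (λ l → Unique.map⁺ ∷-injectiveˡ (Unique.allFin⁺ n))
    (λ l≢l′ (v∈ , v∈′) → l≢l′ (tails-equal v∈ v∈′))
    where
    tails-equal : ∀ {l l′ v} → v ∈ prepend l → v ∈ prepend l′ → l ≡ l′
    tails-equal {l} {l′} v∈ v∈′ with ∈-map⁻ (_∷ l) v∈ | ∈-map⁻ (_∷ l′) v∈′
    ... | _ , _ , refl | _ , _ , eq = ∷-injectiveʳ eq

  allShortLists-unique : Unique (allShortLists n)
  allShortLists-unique = Unique-concatMap⁺ (listsOfLength n) (Unique.upTo⁺ (suc n)) listsOfLength-unique
    λ {k} {k′} k≢k′ (l∈ , l∈′) → k≢k′ (trans (sym (length-listsOfLength k l∈)) (length-listsOfLength k′ l∈′))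

  ∈-allShortLists : ∀ l → length l ≤ n → l ∈ allShortLists n
  ∈-allShortLists l l≤n =
    ∈-concatMap⁺ (listsOfLength n) (Any.map (λ { refl → ∈-listsOfLength l }) (∈-upTo⁺ (s≤s l≤n)))

without : ∀ {n} → (Fin n → Bool) → Fin n → Fin n → Bool
without K m y = K y ∧ not ⌊ y ≟ m ⌋

module _ {n} {K : Fin n → Bool} {m y : Fin n} where

  without⁻ : T (without K m y) → T (K y) × y ≢ m
  without⁻ t with Equivalence.to (T-∧ {K y}) t
  ... | Ky , y≢m = Ky , toWitnessFalse y≢m

  without⁺ : T (K y) → y ≢ m → T (without K m y)
  without⁺ Ky y≢m = Equivalence.from (T-∧ {K y}) (Ky , fromWitnessFalse y≢m)

module LinearExtensionCounting {n} (P : FinPoset n) where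
  open FinPoset P using () renaming (_≺_ to _⊏_)

  IsMinimalIn : (Fin n → Bool) → Fin n → Set
  IsMinimalIn K m = T (K m) × (∀ y → T (K y) → ¬ y ⊏ m)

  linearExtensions : (Fin n → Bool) → List (List (Fin n))
  linearExtensions K = filter (isLinExt? P K) (allShortLists n)

  ∈-linearExtensions⁺ : ∀ {K l} → IsLinExt P K l → l ∈ linearExtensions K
  ∈-linearExtensions⁺ {K} {l} lin =
    ∈-filter⁺ (isLinExt? P K) (∈-allShortLists n l (Unique⇒length≤ (proj₁ lin))) lin

  ∈-linearExtensions⁻ : ∀ {K l} → l ∈ linearExtensions K → IsLinExt P K l
  ∈-linearExtensions⁻ {K} l∈ = proj₂ (∈-filter⁻ (isLinExt? P K) {xs = allShortLists n} l∈)

  linearExtensions-unique : ∀ K → Unique (linearExtensions K)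
  linearExtensions-unique K = Unique.filter⁺ (isLinExt? P K) (allShortLists-unique n)

  eSub≡length : ∀ K {L} → Unique L → (∀ {l} → l ∈ L → IsLinExt P K l) → (∀ {l} → IsLinExt P K l → l ∈ L) →
                eSub P K ≡ length L
  eSub≡length K u sound complete = Unique-⊆⊇⇒length≡ (linearExtensions-unique K) u
    (λ l∈ → complete (∈-linearExtensions⁻ l∈)) (λ l∈ → ∈-linearExtensions⁺ (sound l∈))

  IsLinExt-cong : ∀ {K K′ l} → (∀ y → T (K y) → T (K′ y)) → (∀ y → T (K′ y) → T (K y)) →
                  IsLinExt P K l → IsLinExt P K′ l
  IsLinExt-cong K⊆K′ K′⊆K (u , mem , ordered) =
    u , (λ y → (λ K′y → proj₁ (mem y) (K′⊆K y K′y)) , (λ y∈ → K⊆K′ y (proj₂ (mem y) y∈))) , ordered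

  eSub-cong : ∀ {K K′} → (∀ y → T (K y) → T (K′ y)) → (∀ y → T (K′ y) → T (K y)) →
              eSub P K ≡ eSub P K′
  eSub-cong {K} {K′} K⊆K′ K′⊆K = eSub≡length K (linearExtensions-unique K′)
    (λ l∈ → IsLinExt-cong K′⊆K K⊆K′ (∈-linearExtensions⁻ l∈))
    (λ lin → ∈-linearExtensions⁺ (IsLinExt-cong K⊆K′ K′⊆K lin))

  eSub-empty : ∀ {K} → (∀ y → ¬ T (K y)) → eSub P K ≡ 1
  eSub-empty {K} K-empty = eSub≡length K ([] ∷ [])
    (λ { (here refl) → [] , (λ y → (λ Ky → ⊥-elim (K-empty y Ky)) , λ ()) , [] })
    λ { {[]} _ → here refl ; {x ∷ _} (_ , mem , _) → ⊥-elim (K-empty x (proj₂ (mem x) (here refl))) }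

  ⊏-irrefl : ∀ {x} → ¬ x ⊏ x
  ⊏-irrefl = IsStrictPartialOrder.irrefl (isSPO P) refl

  ∷-IsLinExt : ∀ {K m l} → IsMinimalIn K m → IsLinExt P (without K m) l → IsLinExt P K (m ∷ l)
  ∷-IsLinExt {K} {m} {l} (Km , m-minimal) (u , mem , ordered) =
    All.tabulate (λ z∈ m≡z → proj₂ (kept z∈) (sym m≡z)) ∷ u ,
    (λ y → listed y , λ { (here refl) → Km ; (there y∈) → proj₁ (kept y∈) }) ,
    All.tabulate (λ z∈ → m-minimal _ (proj₁ (kept z∈))) ∷ ordered
    where
    kept : ∀ {z} → z ∈ l → T (K z) × z ≢ m
    kept {z} z∈ = without⁻ {K = K} (proj₂ (mem z) z∈)
    listed : ∀ y → T (K y) → y ∈ m ∷ l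
    listed y Ky with y ≟ m
    ... | yes refl = here refl
    ... | no y≢m   = there (proj₁ (mem y) (without⁺ {K = K} Ky y≢m))

  ∷-IsLinExt⁻ : ∀ {K m l} → IsLinExt P K (m ∷ l) → IsMinimalIn K m × IsLinExt P (without K m) l
  ∷-IsLinExt⁻ {K} {m} {l} (m∉l ∷ u , mem , m-first ∷ ordered) =
    (proj₂ (mem m) (here refl) , m-minimal) ,
    u , (λ y → listed y , kept y) , ordered
    where
    m-minimal : ∀ y → T (K y) → ¬ y ⊏ m
    m-minimal y Ky y⊏m with proj₁ (mem y) Ky
    ... | here refl = ⊏-irrefl y⊏m
    ... | there y∈  = All.lookup m-first y∈ y⊏m
    kept : ∀ y → y ∈ l → T (without K m y)
    kept y y∈ = without⁺ {K = K} (proj₂ (mem y) (there y∈)) λ y≡m → All.lookup m∉l y∈ (sym y≡m)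
    listed : ∀ y → T (without K m y) → y ∈ l
    listed y t with without⁻ {K = K} t
    ... | Ky , y≢m with proj₁ (mem y) Ky
    ...   | here y≡m = ⊥-elim (y≢m y≡m)
    ...   | there y∈ = y∈

  eSub-minimal-sum : ∀ K {M} → Unique M → Σ (Fin n) (λ y → T (K y)) →
                     (∀ {m} → m ∈ M → IsMinimalIn K m) → (∀ {m} → IsMinimalIn K m → m ∈ M) →
                     eSub P K ≡ sum (map (λ m → eSub P (without K m)) M)
  eSub-minimal-sum K {M} M-unique (y , Ky) M-minimal minimal-M = begin
    eSub P K                                        ≡⟨ eSub≡length K unique sound complete ⟩
    length (concatMap startingWith M)               ≡⟨ length-concatMap startingWith M ⟩
    sum (map (λ m → length (startingWith m)) M)     ≡⟨ cong sum (map-cong length-startingWith M) ⟩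
    sum (map (λ m → eSub P (without K m)) M)        ∎
    where
    open ≡-Reasoning
    startingWith : Fin n → List (List (Fin n))
    startingWith m = map (m ∷_) (linearExtensions (without K m))
    length-startingWith : ∀ m → length (startingWith m) ≡ eSub P (without K m)
    length-startingWith m = length-map (m ∷_) (linearExtensions (without K m))
    unique : Unique (concatMap startingWith M)
    unique = Unique-concatMap⁺ startingWith M-unique
      (λ m → Unique.map⁺ ∷-injectiveʳ (linearExtensions-unique (without K m)))
      (λ m≢m′ (l∈ , l∈′) → m≢m′ (same-head l∈ l∈′))
      where
      same-head : ∀ {m m′ l} → l ∈ startingWith m → l ∈ startingWith m′ → m ≡ m′
      same-head {m} {m′} l∈ l∈′ with ∈-map⁻ (m ∷_) l∈ | ∈-map⁻ (m′ ∷_) l∈′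
      ... | _ , _ , refl | _ , _ , eq = ∷-injectiveˡ eq
    sound : ∀ {l} → l ∈ concatMap startingWith M → IsLinExt P K l
    sound l∈ with find (∈-concatMap⁻ startingWith {xs = M} l∈)
    ... | m , m∈M , l∈′ with ∈-map⁻ (m ∷_) l∈′
    ...   | _ , l′∈ , refl = ∷-IsLinExt (M-minimal m∈M) (∈-linearExtensions⁻ l′∈)
    complete : ∀ {l} → IsLinExt P K l → l ∈ concatMap startingWith M
    complete {[]} (_ , mem , _) with proj₁ (mem y) Ky
    ... | ()
    complete {m ∷ l} lin with ∷-IsLinExt⁻ lin
    ... | m-minimal , lin′ =
      ∈-concatMap⁺ startingWith (lose (minimal-M m-minimal) (∈-map⁺ (m ∷_) (∈-linearExtensions⁺ lin′)))

  eSub-unique-minimal : ∀ K m → IsMinimalIn K m → (∀ {x} → IsMinimalIn K x → x ≡ m) →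
                        eSub P K ≡ eSub P (without K m)
  eSub-unique-minimal K m m-minimal unique =
    trans (eSub-minimal-sum K ([] ∷ []) (m , proj₁ m-minimal)
            (λ { (here refl) → m-minimal }) (λ x-minimal → here (unique x-minimal)))
          (ℕ.+-identityʳ _)

  eSub-two-minimal : ∀ K m m′ → m ≢ m′ → IsMinimalIn K m → IsMinimalIn K m′ →
                     (∀ {x} → IsMinimalIn K x → x ≡ m ⊎ x ≡ m′) →
                     eSub P K ≡ eSub P (without K m) + eSub P (without K m′)
  eSub-two-minimal K m m′ m≢m′ m-minimal m′-minimal only =
    trans (eSub-minimal-sum K ((m≢m′ ∷ []) ∷ [] ∷ []) (m , proj₁ m-minimal)
            (λ { (here refl) → m-minimal ; (there (here refl)) → m′-minimal })
            listed)
          (cong (eSub P (without K m) +_) (ℕ.+-identityʳ _))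
    where
    listed : ∀ {x} → IsMinimalIn K x → x ∈ m ∷ m′ ∷ []
    listed x-minimal with only x-minimal
    ... | inj₁ x≡m  = here x≡m
    ... | inj₂ x≡m′ = there (here x≡m′)

toℕ-≢ : ∀ {n} {u v : Fin n} → u ≢ v → toℕ u ≢ toℕ v
toℕ-≢ u≢v eq = u≢v (Fin.toℕ-injective eq)

-- Position p precedes exactly the positions beyond r p, so it is incomparable with p + 1, …, r p.
reachPoset : ∀ N (r : ℕ → ℕ) → (∀ p → p ≤ r p) → FinPoset N
reachPoset N r r-inflationary = record
  { _≺_   = λ u v → r (toℕ u) < toℕ v
  ; isSPO = record
    { isEquivalence = isEquivalence
    ; irrefl        = λ { {u} refl r[u]<u → ℕ.<⇒≱ r[u]<u (r-inflationary (toℕ u)) }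
    ; trans         = λ {_} {v} u≺v v≺w → ℕ.<-trans u≺v (ℕ.≤-<-trans (r-inflationary _) v≺w)
    ; <-resp-≈      = (λ { refl u≺v → u≺v }) , (λ { refl u≺v → u≺v })
    }
  ; _≺?_  = λ u v → r (toℕ u) <? toℕ v
  }

module ReachPoset (N : ℕ) (r : ℕ → ℕ) (r-inflationary : ∀ p → p ≤ r p) where

  P : FinPoset N
  P = reachPoset N r r-inflationary

  open LinearExtensionCounting P public

  Apart : ℕ → ℕ → Set
  Apart p q = ¬ r p < q × ¬ r q < p

  Apart-sym : ∀ {p q} → Apart p q → Apart q p
  Apart-sym (r[p]≮q , r[q]≮p) = r[q]≮p , r[p]≮q

  module _ (non-nested : ∀ {p q} → p < q → q < r p → r q ≡ q) where

    -- q < t ≤ r p puts q strictly inside the reach of p, where r q = q, so q precedes t.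
    no-increasing-antichain₃ : ∀ {p q t} → p < q → q < t → ¬ r p < t → ¬ r q < t → ⊥
    no-increasing-antichain₃ {p} {q} {t} p<q q<t r[p]≮t r[q]≮t =
      r[q]≮t (subst (_< t) (sym (non-nested p<q (ℕ.<-≤-trans q<t (ℕ.≮⇒≥ r[p]≮t)))) q<t)

    no-antichain₃ : ∀ {p q t} → p < q → q ≢ t → p ≢ t → Apart p q → Apart q t → Apart p t → ⊥
    no-antichain₃ {p} {q} {t} p<q q≢t p≢t A[p,q] A[q,t] A[p,t] with ℕ.<-cmp q t
    ... | tri< q<t _ _ = no-increasing-antichain₃ p<q q<t (proj₁ A[p,t]) (proj₁ A[q,t])
    ... | tri≈ _ q≡t _ = q≢t q≡t
    ... | tri> _ _ t<q with ℕ.<-cmp p t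
    ...   | tri< p<t _ _ = no-increasing-antichain₃ p<t t<q (proj₁ A[p,q]) (proj₂ A[q,t])
    ...   | tri≈ _ p≡t _ = p≢t p≡t
    ...   | tri> _ _ t<p = no-increasing-antichain₃ t<p p<q (proj₂ A[q,t]) (proj₁ A[p,q])

    width≤2 : WidthAtMostTwo P
    width≤2 []              _ = z≤n
    width≤2 (_ ∷ [])        _ = s≤s z≤n
    width≤2 (_ ∷ _ ∷ [])    _ = s≤s (s≤s z≤n)
    width≤2 (u ∷ v ∷ w ∷ _) (((u≢v , A[u,v]) ∷ (u≢w , A[u,w]) ∷ _) ∷ ((v≢w , A[v,w]) ∷ _) ∷ _)
      with ℕ.<-cmp (toℕ u) (toℕ v)
    ... | tri< u<v _ _ = ⊥-elim (no-antichain₃ u<v (toℕ-≢ v≢w) (toℕ-≢ u≢w) A[u,v] A[v,w] A[u,w])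
    ... | tri≈ _ u≡v _ = ⊥-elim (u≢v (Fin.toℕ-injective u≡v))
    ... | tri> _ _ v<u = ⊥-elim (no-antichain₃ v<u (toℕ-≢ u≢w) (toℕ-≢ v≢w) (Apart-sym A[u,v]) A[u,w] A[v,w])

  open FinPoset P using () renaming (_≺_ to _⊏_)

  at : ∀ {k} → k < N → Fin N
  at k<N = fromℕ< k<N

  toℕ-at : ∀ {k} (k<N : k < N) → toℕ (at k<N) ≡ k
  toℕ-at k<N = Fin.toℕ-fromℕ< k<N

  ≡-at : ∀ {k y} (k<N : k < N) → toℕ y ≡ k → y ≡ at k<N
  ≡-at k<N y≡k = Fin.toℕ-injective (trans y≡k (sym (toℕ-at k<N)))

  ≡-at⁻ : ∀ {k y} (k<N : k < N) → y ≡ at k<N → toℕ y ≡ k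
  ≡-at⁻ k<N refl = toℕ-at k<N

  at-⊏ : ∀ {k x} (k<N : k < N) → r k < toℕ x → at k<N ⊏ x
  at-⊏ {x = x} k<N = subst (λ j → r j < toℕ x) (sym (toℕ-at k<N))

  ⊏-at⁻ : ∀ {k y} (k<N : k < N) → y ⊏ at k<N → r (toℕ y) < k
  ⊏-at⁻ {y = y} k<N = subst (r (toℕ y) <_) (toℕ-at k<N)

  from : ℕ → Fin N → Bool
  from k y = ⌊ k ≤? toℕ y ⌋

  from+ : ℕ → ℕ → Fin N → Bool
  from+ p k y = ⌊ toℕ y ℕ.≟ p ⌋ ∨ from k y

  eFrom : ℕ → ℕ
  eFrom k = eSub P (from k)

  eFrom+ : ℕ → ℕ → ℕ
  eFrom+ p k = eSub P (from+ p k)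

  module _ {k : ℕ} {y : Fin N} where

    from⁻ : T (from k y) → k ≤ toℕ y
    from⁻ = toWitness

    from⁺ : k ≤ toℕ y → T (from k y)
    from⁺ = fromWitness

    from+⁻ : ∀ {p} → T (from+ p k y) → toℕ y ≡ p ⊎ k ≤ toℕ y
    from+⁻ {p} t = Sum.map toWitness toWitness (Equivalence.to (T-∨ {⌊ toℕ y ℕ.≟ p ⌋}) t)

    from+⁺ : ∀ {p} → toℕ y ≡ p ⊎ k ≤ toℕ y → T (from+ p k y)
    from+⁺ {p} y∈ = Equivalence.from (T-∨ {⌊ toℕ y ℕ.≟ p ⌋}) (Sum.map fromWitness fromWitness y∈)

  at-∈-from : ∀ {k} (k<N : k < N) → T (from k (at k<N))
  at-∈-from k<N = from⁺ (ℕ.≤-reflexive (sym (toℕ-at k<N)))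

  at-p-∈-from+ : ∀ {p k} (p<N : p < N) → T (from+ p k (at p<N))
  at-p-∈-from+ p<N = from+⁺ (inj₁ (toℕ-at p<N))

  at-k-∈-from+ : ∀ {p k} (k<N : k < N) → T (from+ p k (at k<N))
  at-k-∈-from+ k<N = from+⁺ (inj₂ (ℕ.≤-reflexive (sym (toℕ-at k<N))))

  from-at-minimal : ∀ {k} (k<N : k < N) → IsMinimalIn (from k) (at k<N)
  from-at-minimal k<N =
    at-∈-from k<N , λ y Ky y⊏k → ℕ.<⇒≱ (⊏-at⁻ k<N y⊏k) (ℕ.≤-trans (from⁻ Ky) (r-inflationary (toℕ y)))

  from-minimal-only : ∀ {k} (k<N : k < N) → r k ≡ k → ∀ {x} → IsMinimalIn (from k) x → x ≡ at k<N
  from-minimal-only {k} k<N r[k]≡k {x} (Kx , x-minimal) with ℕ.m≤n⇒m<n∨m≡n (from⁻ Kx)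
  ... | inj₂ k≡x = ≡-at k<N (sym k≡x)
  ... | inj₁ k<x =
    ⊥-elim (x-minimal (at k<N) (at-∈-from k<N) (at-⊏ k<N (subst (_< toℕ x) (sym r[k]≡k) k<x)))

  from+-p-minimal : ∀ {p k} (p<N : p < N) → p < k → IsMinimalIn (from+ p k) (at p<N)
  from+-p-minimal {p} {k} p<N p<k =
    at-p-∈-from+ p<N , λ y K′y y⊏p → not-below y (from+⁻ K′y) (⊏-at⁻ p<N y⊏p)
    where
    not-below : ∀ y → toℕ y ≡ p ⊎ k ≤ toℕ y → ¬ r (toℕ y) < p
    not-below y (inj₁ y≡p) r[y]<p = ℕ.<⇒≱ r[y]<p (subst (_≤ r (toℕ y)) y≡p (r-inflationary (toℕ y)))
    not-below y (inj₂ k≤y) r[y]<p = ℕ.<⇒≱ (ℕ.<-trans r[y]<p p<k) (ℕ.≤-trans k≤y (r-inflationary (toℕ y)))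

  from+-k-minimal : ∀ {p k} (k<N : k < N) → k ≤ r p → IsMinimalIn (from+ p k) (at k<N)
  from+-k-minimal {p} {k} k<N k≤r[p] =
    at-k-∈-from+ k<N , λ y K′y y⊏k → not-below y (from+⁻ K′y) (⊏-at⁻ k<N y⊏k)
    where
    not-below : ∀ y → toℕ y ≡ p ⊎ k ≤ toℕ y → ¬ r (toℕ y) < k
    not-below y (inj₁ y≡p) r[y]<k = ℕ.<⇒≱ r[y]<k (subst (λ j → k ≤ r j) (sym y≡p) k≤r[p])
    not-below y (inj₂ k≤y) r[y]<k = ℕ.<⇒≱ r[y]<k (ℕ.≤-trans k≤y (r-inflationary (toℕ y)))

  from+-covered-minimal-only : ∀ {p k} (p<N : p < N) → r p < k ⊎ N ≤ k →
                               ∀ {x} → IsMinimalIn (from+ p k) x → x ≡ at p<N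
  from+-covered-minimal-only {p} {k} p<N covered {x} (K′x , x-minimal) with from+⁻ K′x
  ... | inj₁ x≡p = ≡-at p<N x≡p
  ... | inj₂ k≤x = ⊥-elim (below-x covered)
    where
    below-x : r p < k ⊎ N ≤ k → ⊥
    below-x (inj₁ r[p]<k) = x-minimal (at p<N) (at-p-∈-from+ p<N) (at-⊏ p<N (ℕ.<-≤-trans r[p]<k k≤x))
    below-x (inj₂ N≤k)    = ℕ.<⇒≱ (Fin.toℕ<n x) (ℕ.≤-trans N≤k k≤x)

  from+-minimal-only : ∀ {p k} (p<N : p < N) (k<N : k < N) → r k ≡ k ⊎ r p ≡ k →
                       ∀ {x} → IsMinimalIn (from+ p k) x → x ≡ at p<N ⊎ x ≡ at k<N
  from+-minimal-only {p} {k} p<N k<N blocking {x} (K′x , x-minimal) with from+⁻ K′x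
  ... | inj₁ x≡p = inj₁ (≡-at p<N x≡p)
  ... | inj₂ k≤x with ℕ.m≤n⇒m<n∨m≡n k≤x
  ...   | inj₂ k≡x = inj₂ (≡-at k<N (sym k≡x))
  ...   | inj₁ k<x = ⊥-elim (below-x blocking)
    where
    below-x : r k ≡ k ⊎ r p ≡ k → ⊥
    below-x (inj₁ r[k]≡k) =
      x-minimal (at k<N) (at-k-∈-from+ k<N) (at-⊏ k<N (subst (_< toℕ x) (sym r[k]≡k) k<x))
    below-x (inj₂ r[p]≡k) =
      x-minimal (at p<N) (at-p-∈-from+ p<N) (at-⊏ p<N (subst (_< toℕ x) (sym r[p]≡k) k<x))

  without-from : ∀ {k} (k<N : k < N) → eSub P (without (from k) (at k<N)) ≡ eFrom (suc k)
  without-from {k} k<N = eSub-cong forth back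
    where
    forth : ∀ y → T (without (from k) (at k<N) y) → T (from (suc k) y)
    forth y t with without⁻ {K = from k} {y = y} t
    ... | Ky , y≢k = from⁺ (ℕ.≤∧≢⇒< (from⁻ Ky) λ k≡y → y≢k (≡-at k<N (sym k≡y)))
    back : ∀ y → T (from (suc k) y) → T (without (from k) (at k<N) y)
    back y Sy = without⁺ {K = from k} {y = y} (from⁺ (ℕ.<⇒≤ (from⁻ Sy)))
                  λ y≡k → ℕ.<-irrefl (sym (≡-at⁻ k<N y≡k)) (from⁻ Sy)

  without-from+-p : ∀ {p k} (p<N : p < N) → p < k → eSub P (without (from+ p k) (at p<N)) ≡ eFrom k
  without-from+-p {p} {k} p<N p<k = eSub-cong forth back
    where
    forth : ∀ y → T (without (from+ p k) (at p<N) y) → T (from k y)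
    forth y t with without⁻ {K = from+ p k} {y = y} t
    ... | K′y , y≢p with from+⁻ K′y
    ...   | inj₁ y≡p = ⊥-elim (y≢p (≡-at p<N y≡p))
    ...   | inj₂ k≤y = from⁺ k≤y
    back : ∀ y → T (from k y) → T (without (from+ p k) (at p<N) y)
    back y Ky = without⁺ {K = from+ p k} {y = y} (from+⁺ (inj₂ (from⁻ Ky)))
               λ y≡p → ℕ.<⇒≱ p<k (subst (k ≤_) (≡-at⁻ p<N y≡p) (from⁻ Ky))

  without-from+-k : ∀ {p k} (k<N : k < N) → p < k →
                    eSub P (without (from+ p k) (at k<N)) ≡ eFrom+ p (suc k)
  without-from+-k {p} {k} k<N p<k = eSub-cong forth back
    where
    forth : ∀ y → T (without (from+ p k) (at k<N) y) → T (from+ p (suc k) y)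
    forth y t with without⁻ {K = from+ p k} {y = y} t
    ... | K′y , y≢k with from+⁻ K′y
    ...   | inj₁ y≡p = from+⁺ (inj₁ y≡p)
    ...   | inj₂ k≤y = from+⁺ (inj₂ (ℕ.≤∧≢⇒< k≤y λ k≡y → y≢k (≡-at k<N (sym k≡y))))
    back : ∀ y → T (from+ p (suc k) y) → T (without (from+ p k) (at k<N) y)
    back y S′y with from+⁻ S′y
    ... | inj₁ y≡p = without⁺ {K = from+ p k} {y = y} (from+⁺ (inj₁ y≡p))
                       λ y≡k → ℕ.<-irrefl (trans (sym y≡p) (≡-at⁻ k<N y≡k)) p<k
    ... | inj₂ k<y = without⁺ {K = from+ p k} {y = y} (from+⁺ (inj₂ (ℕ.<⇒≤ k<y)))
                       λ y≡k → ℕ.<-irrefl (sym (≡-at⁻ k<N y≡k)) k<y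

  eFrom≡eFrom+ : ∀ p → eFrom p ≡ eFrom+ p (suc p)
  eFrom≡eFrom+ p =
    eSub-cong (λ y Ky → from+⁺ (split (ℕ.m≤n⇒m<n∨m≡n (from⁻ Ky)))) (λ y K′y → from⁺ (merge (from+⁻ K′y)))
    where
    split : ∀ {y} → p < y ⊎ p ≡ y → y ≡ p ⊎ suc p ≤ y
    split (inj₁ p<y) = inj₂ p<y
    split (inj₂ p≡y) = inj₁ (sym p≡y)
    merge : ∀ {y} → y ≡ p ⊎ suc p ≤ y → p ≤ y
    merge (inj₁ y≡p) = ℕ.≤-reflexive (sym y≡p)
    merge (inj₂ p<y) = ℕ.<⇒≤ p<y

  eFrom-N : eFrom N ≡ 1
  eFrom-N = eSub-empty λ y Ky → ℕ.<⇒≱ (Fin.toℕ<n y) (from⁻ Ky)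

  eFrom-step : ∀ {k} (k<N : k < N) → r k ≡ k → eFrom k ≡ eFrom (suc k)
  eFrom-step {k} k<N r[k]≡k =
    trans (eSub-unique-minimal (from k) (at k<N) (from-at-minimal k<N) (from-minimal-only k<N r[k]≡k))
          (without-from k<N)

  eFrom+-covered : ∀ {p k} (p<N : p < N) → p < k → r p < k ⊎ N ≤ k → eFrom+ p k ≡ eFrom k
  eFrom+-covered {p} {k} p<N p<k covered =
    trans (eSub-unique-minimal (from+ p k) (at p<N) (from+-p-minimal p<N p<k)
                               (from+-covered-minimal-only p<N covered))
          (without-from+-p p<N p<k)

  eFrom+-step : ∀ {p k} (p<N : p < N) (k<N : k < N) → p < k → k ≤ r p → r k ≡ k ⊎ r p ≡ k →
                eFrom+ p k ≡ eFrom k + eFrom+ p (suc k)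
  eFrom+-step {p} {k} p<N k<N p<k k≤r[p] blocking =
    trans (eSub-two-minimal (from+ p k) (at p<N) (at k<N) p≢k
                            (from+-p-minimal p<N p<k) (from+-k-minimal k<N k≤r[p]) (from+-minimal-only p<N k<N blocking))
          (cong₂ _+_ (without-from+-p p<N p<k) (without-from+-k k<N p<k))
    where
    p≢k : at p<N ≢ at k<N
    p≢k p≡k = ℕ.<-irrefl (trans (sym (toℕ-at p<N)) (≡-at⁻ k<N p≡k)) p<k

  e≡eFrom-0 : e P ≡ eFrom 0
  e≡eFrom-0 = eSub-cong (λ y _ → from⁺ {y = y} z≤n) (λ _ _ → _)

  eMinus≡eFrom-1 : (0<N : 0 < N) → eMinus P (at 0<N) ≡ eFrom 1
  eMinus≡eFrom-1 0<N = trans (eSub-cong forth back) (without-from 0<N)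
    where
    -- The set kept by eMinus P x is definitionally without (λ _ → true) x.
    forth : ∀ y → T (not ⌊ y ≟ at 0<N ⌋) → T (without (from 0) (at 0<N) y)
    forth y t = without⁺ {K = from 0} {y = y} (from⁺ {y = y} z≤n) (proj₂ (without⁻ {K = λ _ → true} {y = y} t))
    back : ∀ y → T (without (from 0) (at 0<N) y) → T (not ⌊ y ≟ at 0<N ⌋)
    back y t = without⁺ {K = λ _ → true} {y = y} _ (proj₂ (without⁻ {K = from 0} {y = y} t))

  at-0-minimal : (0<N : 0 < N) → IsMinimal P (at 0<N)
  at-0-minimal 0<N y y⊏0 = ℕ.n≮0 (subst (r (toℕ y) <_) (toℕ-at 0<N) y⊏0)

  module Block {o a} (0<a : 0 < a) (o+a≤N : o + a ≤ N) (r[o] : r o ≡ o + a)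
               (r-interior : ∀ {j} → 0 < j → j < a → r (o + j) ≡ o + j) where

    q : ℕ
    q = o + a

    private
      o<N : o < N
      o<N = ℕ.<-≤-trans (ℕ.m<m+n o 0<a) o+a≤N

      o+j<N : ∀ {j} → j < a → o + j < N
      o+j<N j<a = ℕ.<-≤-trans (ℕ.+-monoʳ-< o j<a) o+a≤N

      o+j≡q : ∀ {j} → j + 0 ≡ a → o + j ≡ q
      o+j≡q {j} j+0≡a = cong (o +_) (trans (sym (ℕ.+-identityʳ j)) j+0≡a)

      j<a : ∀ {j d} → j + suc d ≡ a → j < a
      j<a {j} j+sd≡a = subst (j <_) j+sd≡a (ℕ.m<m+n j (s≤s z≤n))

      next : ∀ {j d} → j + suc d ≡ a → suc j + d ≡ a
      next {j} {d} j+sd≡a = trans (sym (ℕ.+-suc j d)) j+sd≡a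

    eFrom-interior : ∀ d {j} → j + d ≡ a → 0 < j → eFrom (o + j) ≡ eFrom q
    eFrom-interior zero    j+0≡a _       = cong eFrom (o+j≡q j+0≡a)
    eFrom-interior (suc d) {j} j+d≡a 0<j = begin
      eFrom (o + j)        ≡⟨ eFrom-step (o+j<N (j<a j+d≡a)) (r-interior 0<j (j<a j+d≡a)) ⟩
      eFrom (suc (o + j))  ≡⟨ cong eFrom (ℕ.+-suc o j) ⟨
      eFrom (o + suc j)    ≡⟨ eFrom-interior d (next j+d≡a) (s≤s z≤n) ⟩
      eFrom q              ∎
      where open ≡-Reasoning

    eFrom+-interior : ∀ d {j} → j + d ≡ a → 0 < j → eFrom+ o (o + j) ≡ d * eFrom q + eFrom+ o q
    eFrom+-interior zero    j+0≡a _       = cong (eFrom+ o) (o+j≡q j+0≡a)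
    eFrom+-interior (suc d) {j} j+d≡a 0<j = begin
      eFrom+ o (o + j)                         ≡⟨ eFrom+-step o<N (o+j<N (j<a j+d≡a)) (ℕ.m<m+n o 0<j) o+j≤r[o]
                                                                (inj₁ (r-interior 0<j (j<a j+d≡a))) ⟩
      eFrom (o + j) + eFrom+ o (suc (o + j))   ≡⟨ cong (_+ eFrom+ o (suc (o + j))) (eFrom-interior (suc d) j+d≡a 0<j) ⟩
      eFrom q + eFrom+ o (suc (o + j))         ≡⟨ cong (λ k → eFrom q + eFrom+ o k) (ℕ.+-suc o j) ⟨
      eFrom q + eFrom+ o (o + suc j)           ≡⟨ cong (eFrom q +_) (eFrom+-interior d (next j+d≡a) (s≤s z≤n)) ⟩
      eFrom q + (d * eFrom q + eFrom+ o q)     ≡⟨ ℕ.+-assoc (eFrom q) (d * eFrom q) (eFrom+ o q) ⟨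
      suc d * eFrom q + eFrom+ o q             ∎
      where
      open ≡-Reasoning
      o+j≤r[o] : o + j ≤ r o
      o+j≤r[o] = subst (o + j ≤_) (sym r[o]) (ℕ.+-monoʳ-≤ o (ℕ.<⇒≤ (j<a j+d≡a)))

    private
      1+[a∸1]≡a : 1 + (a ∸ 1) ≡ a
      1+[a∸1]≡a = ℕ.m+[n∸m]≡n 0<a

    eFrom-suc-start : eFrom (suc o) ≡ eFrom q
    eFrom-suc-start = trans (cong eFrom (ℕ.+-comm 1 o)) (eFrom-interior (a ∸ 1) 1+[a∸1]≡a (s≤s z≤n))

    eFrom-start : eFrom o ≡ (a ∸ 1) * eFrom q + eFrom+ o q
    eFrom-start = begin
      eFrom o             ≡⟨ eFrom≡eFrom+ o ⟩
      eFrom+ o (suc o)    ≡⟨ cong (eFrom+ o) (ℕ.+-comm 1 o) ⟩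
      eFrom+ o (o + 1)    ≡⟨ eFrom+-interior (a ∸ 1) 1+[a∸1]≡a (s≤s z≤n) ⟩
      (a ∸ 1) * eFrom q + eFrom+ o q ∎
      where open ≡-Reasoning

    eFrom-start-final : q ≡ N → eFrom o ≡ a
    eFrom-start-final q≡N = begin
      eFrom o                           ≡⟨ eFrom-start ⟩
      (a ∸ 1) * eFrom q + eFrom+ o q    ≡⟨ cong₂ (λ x y → (a ∸ 1) * x + y) eFrom-q eFrom+-q ⟩
      (a ∸ 1) * 1 + 1                   ≡⟨ cong (_+ 1) (ℕ.*-identityʳ (a ∸ 1)) ⟩
      a ∸ 1 + 1                         ≡⟨ ℕ.m∸n+n≡m 0<a ⟩
      a                                 ∎
      where
      open ≡-Reasoning
      eFrom-q : eFrom q ≡ 1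
      eFrom-q = trans (cong eFrom q≡N) eFrom-N
      eFrom+-q : eFrom+ o q ≡ 1
      eFrom+-q = trans (eFrom+-covered o<N (ℕ.m<m+n o 0<a) (inj₂ (ℕ.≤-reflexive (sym q≡N)))) eFrom-q

    eFrom-start-inner : q < N → eFrom o ≡ a * eFrom q + eFrom (suc q)
    eFrom-start-inner q<N = begin
      eFrom o                                          ≡⟨ eFrom-start ⟩
      (a ∸ 1) * eFrom q + eFrom+ o q                   ≡⟨ cong ((a ∸ 1) * eFrom q +_) eFrom+-q ⟩
      (a ∸ 1) * eFrom q + (eFrom q + eFrom (suc q))    ≡⟨ ∸1-*-+ 0<a (eFrom q) (eFrom (suc q)) ⟩
      a * eFrom q + eFrom (suc q)                      ∎
      where
      open ≡-Reasoning
      o<q : o < q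
      o<q = ℕ.m<m+n o 0<a
      eFrom+-q : eFrom+ o q ≡ eFrom q + eFrom (suc q)
      eFrom+-q = trans (eFrom+-step o<N q<N o<q (ℕ.≤-reflexive (sym r[o])) (inj₂ r[o]))
                       (cong (eFrom q +_) (eFrom+-covered o<N (ℕ.m<n⇒m<1+n o<q) (inj₁ (s≤s (ℕ.≤-reflexive r[o])))))
      ∸1-*-+ : ∀ {a} → 0 < a → ∀ F G → (a ∸ 1) * F + (F + G) ≡ a * F + G
      ∸1-*-+ {suc a} _ F G = identity a F G
        where
        identity : ∀ a F G → a * F + (F + G) ≡ F + a * F + G
        identity = solve-∀

-- reach bs sends the first position of each block of lengths bs to the first position of the next
-- block (or to their total length) and fixes every other position.
reach : List ℕ → ℕ → ℕ
reach []       p       = p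
reach (a ∷ as) zero    = a
reach (a ∷ as) (suc p) with suc p <? a
... | yes _ = suc p
... | no  _ = a + reach as (suc p ∸ a)

reach-inflationary : ∀ bs p → p ≤ reach bs p
reach-inflationary []       p       = ℕ.≤-refl
reach-inflationary (a ∷ bs) zero    = z≤n
reach-inflationary (a ∷ bs) (suc p) with suc p <? a
... | yes _ = ℕ.≤-refl
... | no  _ = ℕ.≤-trans (ℕ.m≤n+m∸n (suc p) a) (ℕ.+-monoʳ-≤ a (reach-inflationary bs (suc p ∸ a)))

reach-interior : ∀ {a j} bs → 0 < j → j < a → reach (a ∷ bs) j ≡ j
reach-interior {a} {suc j} bs _ j<a with suc j <? a
... | yes _   = refl
... | no  j≮a = contradiction j<a j≮a

reach-shift : ∀ {a} bs k → 0 < a → reach (a ∷ bs) (a + k) ≡ a + reach bs k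
reach-shift {suc a} bs k _ with suc (a + k) <? suc a
... | yes a+k<a = contradiction a+k<a (ℕ.≤⇒≯ (ℕ.m≤m+n (suc a) k))
... | no  _     = cong (λ i → suc a + reach bs i) (ℕ.m+n∸m≡n a k)

reach-non-nested : ∀ bs → All (0 <_) bs → ∀ {p q} → p < q → q < reach bs p → reach bs q ≡ q
reach-non-nested []       _            p<q q<p = contradiction q<p (ℕ.<⇒≯ p<q)
reach-non-nested (a ∷ bs) (_ ∷ _)      {zero}  {q} 0<q q<a = reach-interior bs 0<q q<a
reach-non-nested (a ∷ bs) (0<a ∷ 0<bs) {suc p} {q} p<q q<r[p] with suc p <? a
... | yes _   = contradiction q<r[p] (ℕ.<⇒≯ p<q)
... | no  p≮a = begin
  reach (a ∷ bs) q                 ≡⟨ cong (reach (a ∷ bs)) a+[q∸a]≡q ⟨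
  reach (a ∷ bs) (a + (q ∸ a))   ≡⟨ reach-shift bs (q ∸ a) 0<a ⟩
  a + reach bs (q ∸ a)           ≡⟨ cong (a +_) (reach-non-nested bs 0<bs shifted-p<q shifted-q<r[p]) ⟩
  a + (q ∸ a)                    ≡⟨ a+[q∸a]≡q ⟩
  q                                ∎
  where
  open ≡-Reasoning
  a≤p : a ≤ suc p
  a≤p = ℕ.≮⇒≥ p≮a
  a+[p∸a]≡p : a + (suc p ∸ a) ≡ suc p
  a+[p∸a]≡p = ℕ.m+[n∸m]≡n a≤p
  a+[q∸a]≡q : a + (q ∸ a) ≡ q
  a+[q∸a]≡q = ℕ.m+[n∸m]≡n (ℕ.≤-trans a≤p (ℕ.<⇒≤ p<q))
  shifted-p<q : suc p ∸ a < q ∸ a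
  shifted-p<q = ℕ.+-cancelˡ-< a _ _ (subst₂ _<_ (sym a+[p∸a]≡p) (sym a+[q∸a]≡q) p<q)
  shifted-q<r[p] : q ∸ a < reach bs (suc p ∸ a)
  shifted-q<r[p] = ℕ.+-cancelˡ-< a _ _ (subst (_< a + reach bs (suc p ∸ a)) (sym a+[q∸a]≡q) q<r[p])

module BlockPoset (bs : List ℕ) where

  open ReachPoset (sum bs) (reach bs) (reach-inflationary bs) public

  -- The blocks of bs from position o on are L.
  SuffixAt : ℕ → List ℕ → Set
  SuffixAt o L = ∀ k → reach bs (o + k) ≡ o + reach L k

  module _ {o a L} (suffix : SuffixAt o (a ∷ L)) where

    suffix-start : reach bs o ≡ o + a
    suffix-start = trans (cong (reach bs) (sym (ℕ.+-identityʳ o))) (suffix 0)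

    suffix-interior : ∀ {j} → 0 < j → j < a → reach bs (o + j) ≡ o + j
    suffix-interior {j} 0<j j<a = trans (suffix j) (cong (o +_) (reach-interior L 0<j j<a))

    suffix-next : 0 < a → SuffixAt (o + a) L
    suffix-next 0<a k = begin
      reach bs (o + a + k)     ≡⟨ cong (reach bs) (ℕ.+-assoc o a k) ⟩
      reach bs (o + (a + k))   ≡⟨ suffix (a + k) ⟩
      o + reach (a ∷ L) (a + k) ≡⟨ cong (o +_) (reach-shift L k 0<a) ⟩
      o + (a + reach L k)      ≡⟨ ℕ.+-assoc o a (reach L k) ⟨
      o + a + reach L k        ∎
      where open ≡-Reasoning

  eFrom-continuants : ∀ {o a} L → 0 < a → All (0 <_) L → SuffixAt o (a ∷ L) → o + (a + sum L) ≡ sum bs →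
                      eFrom o ≡ numerator a L × eFrom (suc o) ≡ denominator L
  eFrom-continuants {o} {a} [] 0<a [] suffix size =
    eFrom-start-final q≡N , trans eFrom-suc-start (trans (cong eFrom q≡N) eFrom-N)
    where
    q≡N : o + a ≡ sum bs
    q≡N = trans (cong (o +_) (sym (ℕ.+-identityʳ a))) size
    open Block 0<a (ℕ.≤-reflexive q≡N) (suffix-start suffix) (suffix-interior suffix)
  eFrom-continuants {o} {a} (b ∷ L) 0<a (0<b ∷ 0<L) suffix size =
    trans (eFrom-start-inner q<N) (cong₂ (λ x y → a * x + y) (proj₁ next-block) (proj₂ next-block)) ,
    trans eFrom-suc-start (proj₁ next-block)
    where
    size′ : o + a + (b + sum L) ≡ sum bs
    size′ = trans (ℕ.+-assoc o a (b + sum L)) size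
    q<N : o + a < sum bs
    q<N = subst (o + a <_) size′ (ℕ.m<m+n (o + a) (ℕ.<-≤-trans 0<b (ℕ.m≤m+n b (sum L))))
    open Block 0<a (ℕ.<⇒≤ q<N) (suffix-start suffix) (suffix-interior suffix)
    next-block : eFrom (o + a) ≡ numerator b L × eFrom (suc (o + a)) ≡ denominator L
    next-block = eFrom-continuants L 0<b 0<L (suffix-next suffix 0<a) size′

proposition8p1 : (a₀ : ℕ) (as : List ℕ) → 0 < a₀ → All (0 <_) as →
    Σ (FinPoset (a₀ + sum as)) λ P → WidthAtMostTwo P ×
      Σ (Fin (a₀ + sum as)) λ x → IsMinimal P x × ρ P x ≡ cf a₀ as
proposition8p1 a₀ as 0<a₀ 0<as =
  P , width≤2 (reach-non-nested (a₀ ∷ as) (0<a₀ ∷ 0<as)) , at 0<N , at-0-minimal 0<N , ρ≡cf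
  where
  open BlockPoset (a₀ ∷ as)
  0<N : 0 < a₀ + sum as
  0<N = ℕ.<-≤-trans 0<a₀ (ℕ.m≤m+n a₀ (sum as))
  counts : eFrom 0 ≡ numerator a₀ as × eFrom 1 ≡ denominator as
  counts = eFrom-continuants as 0<a₀ 0<as (λ _ → refl) refl
  ρ≡cf : ρ P (at 0<N) ≡ cf a₀ as
  ρ≡cf = begin
    frac (e P) (eMinus P (at 0<N))            ≡⟨ cong₂ frac e≡eFrom-0 (eMinus≡eFrom-1 0<N) ⟩
    frac (eFrom 0) (eFrom 1)                  ≡⟨ cong₂ frac (proj₁ counts) (proj₂ counts) ⟩
    frac (numerator a₀ as) (denominator as)   ≡⟨ cf-continuants a₀ as 0<as ⟩
    cf a₀ as                                  ∎
    where open ≡-Reasoning
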